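{- Let $\mathcal{H}=(\mathcal{V},\mathcal{E})$ be a connected hypergraph with a vertex $w$ and two proper subsets $\mathcal{V}_1,\mathcal{V}_2$ of $\mathcal{V}$ such that $\mathcal{V}_1\cup\mathcal{V}_2=\mathcal{V}$, $\mathcal{V}_1\cap\mathcal{V}_2=\{w\}$, and every $e\in\mathcal{E}$ either contains $w$ or is contained in $\mathcal{V}_i$ for some $i\in\{1,2\}$. Then $(\lambda-1)^2$ divides $P(\mathcal{H},\lambda)$ if and only if $\lambda^2$ divides $$\sum_{\mathcal{V}_0\in\mathcal{I}_{(\mathcal{V}_1,\mathcal{V}_2)}(\mathcal{H})}P(\mathcal{H}-\mathcal{V}_0,\lambda),$$ where $\mathcal{I}_{(\mathcal{V}_1,\mathcal{V}_2)}(\mathcal{H})$ is the set of $\mathcal{V}_0\in\mathcal{I}(\mathcal{H})$ such that $\mathcal{V}_i\subseteq\mathcal{V}_0$ for some $i\in\{1,2\}$.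
   Context: A hypergraph $\mathcal{H}=(\mathcal{V},\mathcal{E})$ has a finite vertex set $\mathcal{V}$ and a set $\mathcal{E}$ of subsets of $\mathcal{V}$ of size at least 1. For positive integer $\lambda$, a weak proper $\lambda$-colouring is a map $\phi:\mathcal{V}\to\{1,\dots,\lambda\}$ with $|\{\phi(v):v\in e\}|>1$ for each $e\in\mathcal{E}$; $P(\mathcal{H},\lambda)$ is the polynomial counting them. $\mathcal{H}$ is connected if any two vertices $v_1,v_2$ are joined by edges $e_0,\dots,e_k$ with $v_1\in e_0$, $v_2\in e_k$, $e_i\cap e_{i+1}\neq\emptyset$. $\mathcal{I}(\mathcal{H})$ is the set of subsets $\mathcal{V}_0\subseteq\mathcal{V}$ containing no edge of $\mathcal{H}$. $\mathcal{H}-\mathcal{V}_0$ is the hypergraph with vertex set $\mathcal{V}\setminus\mathcal{V}_0$ and edge set $\{e\in\mathcal{E}:e\subseteq\mathcal{V}\setminus\mathcal{V}_0\}$. -}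

module Defs where

open import Data.Nat using (ℕ; zero; suc)
open import Data.Fin using (Fin)
open import Data.Fin.Properties using (any?)
open import Data.Fin.Subset using (Subset; _∈_; _⊆_; _─_; ⊥)
open import Data.Fin.Subset.Properties using (_∈?_; _⊆?_)
open import Data.Bool using (true; false)
open import Data.Vec using (Vec; []; _∷_; lookup)
open import Data.Maybe using (Maybe; just; nothing)
import Data.Maybe.Properties as MaybeP
open import Data.Fin.Properties using (_≟_)
open import Data.List using (List; []; _∷_; map; concatMap; filter; length)
open import Data.Nat.ListAction using (sum)
open import Data.List.Relation.Unary.All using (All; all?)
open import Data.List.Relation.Unary.Any using (Any)
open import Data.Product using (Σ; ∃; _×_; _,_)
open import Data.Sum using (_⊎_)
open import Data.Integer using (ℤ; +_; _*_; _-_; _+_; 1ℤ; 0ℤ)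
open import Relation.Nullary using (¬_; Dec)
open import Relation.Nullary.Decidable using (_×-dec_; _⊎-dec_; ¬?)
open import Relation.Binary.PropositionalEquality using (_≡_)

record Hypergraph (n : ℕ) : Set where
  constructor hypergraph
  field
    V : Subset n
    E : List (Subset n)
open Hypergraph public

WellFormed : ∀ {n} → Hypergraph n → Set
WellFormed H = All (λ e → Σ (Fin _) (λ x → x ∈ e) × e ⊆ V H) (E H)

data Linked {n : ℕ} (H : Hypergraph n) : Fin n → Fin n → Set where
  single : ∀ {e v w} → Any (e ≡_) (E H) → v ∈ e → w ∈ e → Linked H v w
  step   : ∀ {e v u w} → Any (e ≡_) (E H) → v ∈ e → u ∈ e → Linked H u w → Linked H v w

Connected : ∀ {n} → Hypergraph n → Set
Connected H = ∀ v₁ v₂ → v₁ ∈ V H → v₂ ∈ V H → Linked H v₁ v₂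

_∖ᴴ_ : ∀ {n} → Hypergraph n → Subset n → Hypergraph n
H ∖ᴴ V₀ = hypergraph (V H ─ V₀) (filter (λ e → e ⊆? (V H ─ V₀)) (E H))

-- All maps W → Fin k, represented as vectors that are `nothing` outside W.
colourings : ∀ {n} → Subset n → (k : ℕ) → List (Vec (Maybe (Fin k)) n)
colourings {zero} [] k = [] ∷ []
colourings {suc n} (false ∷ W) k = map (nothing ∷_) (colourings W k)
colourings {suc n} (true ∷ W) k =
  concatMap (λ c → map (just c ∷_) (colourings W k)) (allFinL k)
  where
  allFinL : (k : ℕ) → List (Fin k)
  allFinL zero = []
  allFinL (suc k) = Fin.zero ∷ map Fin.suc (allFinL k)
    where import Data.Fin as Fin

NonMono : ∀ {n k} → Vec (Maybe (Fin k)) n → Subset n → Set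
NonMono c e = ∃ λ i → ∃ λ j → i ∈ e × j ∈ e × ¬ (lookup c i ≡ lookup c j)

nonMono? : ∀ {n k} (c : Vec (Maybe (Fin k)) n) (e : Subset n) → Dec (NonMono c e)
nonMono? c e = any? λ i → any? λ j →
  (i ∈? e) ×-dec ((j ∈? e) ×-dec ¬? (MaybeP.≡-dec _≟_ (lookup c i) (lookup c j)))

Proper : ∀ {n k} → Hypergraph n → Vec (Maybe (Fin k)) n → Set
Proper H c = All (NonMono c) (E H)

P : ∀ {n} → Hypergraph n → ℕ → ℕ
P H k = length (filter (λ c → all? (nonMono? c) (E H)) (colourings (V H) k))

subsets : (n : ℕ) → List (Subset n)
subsets zero = [] ∷ []
subsets (suc n) = map (false ∷_) (subsets n) Data.List.++ map (true ∷_) (subsets n)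
  where import Data.List

Independent : ∀ {n} → Hypergraph n → Subset n → Set
Independent H V₀ = V₀ ⊆ V H × All (λ e → ¬ (e ⊆ V₀)) (E H)

InI₁₂ : ∀ {n} → Hypergraph n → Subset n → Subset n → Subset n → Set
InI₁₂ H V₁ V₂ V₀ = Independent H V₀ × (V₁ ⊆ V₀ ⊎ V₂ ⊆ V₀)

inI₁₂? : ∀ {n} (H : Hypergraph n) V₁ V₂ V₀ → Dec (InI₁₂ H V₁ V₂ V₀)
inI₁₂? H V₁ V₂ V₀ =
  ((V₀ ⊆? V H) ×-dec all? (λ e → ¬? (e ⊆? V₀)) (E H)) ×-dec ((V₁ ⊆? V₀) ⊎-dec (V₂ ⊆? V₀))

Psum : ∀ {n} → Hypergraph n → Subset n → Subset n → ℕ → ℕ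
Psum H V₁ V₂ k = sum (map (λ V₀ → P (H ∖ᴴ V₀) k) (filter (inI₁₂? H V₁ V₂) (subsets _)))

-- Integer polynomials as coefficient lists (constant term first).
eval : List ℤ → ℤ → ℤ
eval [] x = 0ℤ
eval (a ∷ as) x = a + x * eval as x

-- "d(λ) divides f(λ)" in ℤ[λ], for f given by its values on positive integers
-- (a polynomial is determined by these values; d is monic below).
PolyDivides : (ℤ → ℤ) → (ℕ → ℕ) → Set
PolyDivides d f = ∃ λ (q : List ℤ) → ∀ (k : ℕ) → 1 Data.Nat.≤ k → + f k ≡ d (+ k) * eval q (+ k)
  where import Data.Nat

{-# OPTIONS --safe #-}

-- Splitting off the vertices of one colour gives P(H, λ+1) = Σ_{C ∈ I(H)} P(H − C, λ), and sorting
-- the colourings by the colour of a vertex v gives P(H, λ+1) = (λ+1) Σ_{v ∈ C ∈ I(H)} P(H − C, λ).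
-- Take v = w and sort the C ∈ I(H) by how they meet the cut.  Those with V₁ ⊆ C or V₂ ⊆ C make up
-- the sum in the statement.  Those avoiding w contribute λ Σ_{w ∈ C ∈ I(H)} P(H − C, λ), where each
-- term is divisible by λ because H − C keeps a vertex of an edge.  For the others, H − C falls
-- apart into its nonempty parts on V₁ − C and V₂ − C, so P(H − C, λ) is a product of two multiples
-- of λ.  Hence P(H, λ+1) agrees with the sum modulo λ² for every λ ≥ 1, and a polynomial p with
-- m² ∣ p(a + m) for all m ≥ 1 is divisible by (x − a)².

module Submission where

open import Defs
open import Data.Nat using (ℕ)
open import Data.Fin using (Fin)
open import Data.Fin.Subset using (Subset; _∈_; _⊆_; _⊂_; _∪_; _∩_; ⁅_⁆)
open import Data.List.Relation.Unary.All using (All)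
open import Data.Sum using (_⊎_)
open import Data.Integer using (_*_; _-_; 1ℤ)
open import Function.Bundles using (_⇔_)
open import Relation.Binary.PropositionalEquality using (_≡_)

open import Data.Product using (_×_; _,_; proj₁; proj₂; ∃-syntax)
open import Data.List using (List; []; _∷_; _++_; map; filter; length; concatMap; tabulate; allFin)
open import Relation.Binary.PropositionalEquality using (_≢_; refl; sym; trans; cong; cong₂; subst; module ≡-Reasoning)
open import Function using (_∘_; id; mk⇔; Equivalence)

open ≡-Reasoning

module IntegerPolynomials where

  open import Data.Nat as ℕ using (zero; suc; s≤s; z≤n)
  import Data.Nat.Properties as ℕ
  open import Data.Nat.Divisibility using (>⇒∤) renaming (_∣_ to _∣ℕ_)
  open import Data.Integer using (ℤ; +_; -[1+_]; _+_; 0ℤ; ∣_∣)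
  open import Data.Integer.Properties using (pos-+; pos-*; ∣i∣≡0⇒i≡0; +-identityˡ; +-identityʳ; *-zeroʳ)
  open import Data.Integer.Divisibility.Signed
    using (_∣_; ∣⇒∣ᵤ; ∣ᵤ⇒∣; ∣m+n∣n⇒∣m; ∣m∣n⇒∣m+n; ∣m⇒∣m*n; ∣-trans; *-cancelˡ-∣; ∣-refl)
  open import Data.Integer.Tactic.RingSolver using (solve-∀)
  open import Relation.Nullary using (contradiction)

  Polynomial : (ℕ → ℕ) → Set
  Polynomial f = ∃[ p ] ∀ k → + f k ≡ eval p (+ k)

  infixl 6 _+ₚ_
  _+ₚ_ : List ℤ → List ℤ → List ℤ
  []      +ₚ q       = q
  (a ∷ p) +ₚ []      = a ∷ p
  (a ∷ p) +ₚ (b ∷ q) = a + b ∷ p +ₚ q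

  eval-+ₚ : ∀ p q x → eval (p +ₚ q) x ≡ eval p x + eval q x
  eval-+ₚ []      q       x = sym (+-identityˡ _)
  eval-+ₚ (a ∷ p) []      x = sym (+-identityʳ _)
  eval-+ₚ (a ∷ p) (b ∷ q) x = trans (cong (λ t → a + b + x * t) (eval-+ₚ p q x)) (regroup a b x _ _)
    where
    regroup : ∀ a b x s t → a + b + x * (s + t) ≡ a + x * s + (b + x * t)
    regroup = solve-∀

  infixl 7 _·ₚ_
  _·ₚ_ : ℤ → List ℤ → List ℤ
  c ·ₚ p = map (c *_) p

  eval-·ₚ : ∀ c p x → eval (c ·ₚ p) x ≡ c * eval p x
  eval-·ₚ c []      x = sym (*-zeroʳ c)
  eval-·ₚ c (a ∷ p) x = trans (cong (λ t → c * a + x * t) (eval-·ₚ c p x)) (distrib c a x _)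
    where
    distrib : ∀ c a x t → c * a + x * (c * t) ≡ c * (a + x * t)
    distrib = solve-∀

  shift : ℤ → List ℤ → List ℤ
  shift a []      = []
  shift a (c ∷ p) = (c ∷ shift a p) +ₚ a ·ₚ shift a p

  eval-shift : ∀ a p x → eval (shift a p) x ≡ eval p (x + a)
  eval-shift a []      x = refl
  eval-shift a (c ∷ p) x = begin
    eval ((c ∷ shift a p) +ₚ a ·ₚ shift a p) x
      ≡⟨ eval-+ₚ (c ∷ shift a p) (a ·ₚ shift a p) x ⟩
    c + x * eval (shift a p) x + eval (a ·ₚ shift a p) x
      ≡⟨ cong (_+_ (c + x * eval (shift a p) x)) (eval-·ₚ a (shift a p) x) ⟩
    c + x * eval (shift a p) x + a * eval (shift a p) x
      ≡⟨ cong (λ t → c + x * t + a * t) (eval-shift a p x) ⟩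
    c + x * eval p (x + a) + a * eval p (x + a)
      ≡⟨ factor c x a _ ⟩
    c + (x + a) * eval p (x + a) ∎
    where
    factor : ∀ c x a t → c + x * t + a * t ≡ c + (x + a) * t
    factor = solve-∀

  polynomial-cong : ∀ {f g} → (∀ k → f k ≡ g k) → Polynomial f → Polynomial g
  polynomial-cong f≗g (p , f≡p) = p , λ k → trans (cong +_ (sym (f≗g k))) (f≡p k)

  polynomial-const : ∀ c → Polynomial (λ _ → c)
  polynomial-const c = (+ c ∷ []) , λ k → sym (trans (cong (_+_ (+ c)) (*-zeroʳ (+ k))) (+-identityʳ (+ c)))

  polynomial-+ : ∀ {f g} → Polynomial f → Polynomial g → Polynomial (λ k → f k ℕ.+ g k)
  polynomial-+ {f} {g} (p , f≡p) (q , g≡q) =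
    p +ₚ q , λ k → trans (pos-+ (f k) (g k)) (trans (cong₂ _+_ (f≡p k) (g≡q k)) (sym (eval-+ₚ p q (+ k))))

  -- The witness is x · T(x - 1).
  polynomial-suc* : ∀ {f T} → Polynomial T → f 0 ≡ 0 → (∀ k → f (suc k) ≡ suc k ℕ.* T k) → Polynomial f
  polynomial-suc* {f} {T} (p , T≡p) f0≡0 f-suc = 0ℤ ∷ shift -[1+ 0 ] p , λ where
    zero    → cong +_ f0≡0
    (suc k) → begin
      + f (suc k)                                ≡⟨ cong +_ (f-suc k) ⟩
      + (suc k ℕ.* T k)                           ≡⟨ pos-* (suc k) (T k) ⟩
      + suc k * + T k                            ≡⟨ cong (+ suc k *_) (T≡p k) ⟩
      + suc k * eval p (+ suc k + -[1+ 0 ])      ≡⟨ cong (+ suc k *_) (sym (eval-shift -[1+ 0 ] p (+ suc k))) ⟩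
      + suc k * eval (shift -[1+ 0 ] p) (+ suc k) ≡⟨ sym (+-identityˡ _) ⟩
      0ℤ + + suc k * eval (shift -[1+ 0 ] p) (+ suc k) ∎

  divideBy : ℤ → List ℤ → List ℤ
  divideBy a []      = []
  divideBy a (c ∷ p) = eval p a ∷ divideBy a p

  eval-divideBy : ∀ a p x → eval p x ≡ eval p a + (x - a) * eval (divideBy a p) x
  eval-divideBy a []      x = sym (trans (+-identityˡ _) (*-zeroʳ (x - a)))
  eval-divideBy a (c ∷ p) x = begin
    c + x * eval p x
      ≡⟨ cong (λ t → c + x * t) (eval-divideBy a p x) ⟩
    c + x * (eval p a + (x - a) * eval (divideBy a p) x)
      ≡⟨ regroup c x a (eval p a) _ ⟩
    c + a * eval p a + (x - a) * (eval p a + x * eval (divideBy a p) x) ∎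
    where
    regroup : ∀ c x a s t → c + x * (s + (x - a) * t) ≡ c + a * s + (x - a) * (s + x * t)
    regroup = solve-∀

  divisible-by-all⇒≡0 : ∀ {z} → (∀ m → + suc m ∣ z) → z ≡ 0ℤ
  divisible-by-all⇒≡0 {z} all∣z = ∣i∣≡0⇒i≡0 (suc∣⇒≡0 ∣ z ∣ (∣⇒∣ᵤ (all∣z ∣ z ∣)))
    where
    suc∣⇒≡0 : ∀ a → suc a ∣ℕ a → a ≡ 0
    suc∣⇒≡0 zero    _   = refl
    suc∣⇒≡0 (suc a) a∣a = contradiction a∣a (>⇒∤ ℕ.≤-refl)

  double-root : ∀ a p → (∀ m → + suc m * + suc m ∣ eval p (a + + suc m)) →
                ∃[ q ] ∀ x → eval p x ≡ (x - a) * (x - a) * eval q x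
  double-root a p square∣ = q , λ x → begin
    eval p x
      ≡⟨ expand x ⟩
    eval p a + (x - a) * (eval D a + (x - a) * eval q x)
      ≡⟨ cong₂ (λ s t → s + (x - a) * (t + (x - a) * eval q x)) p-root D-root ⟩
    0ℤ + (x - a) * (0ℤ + (x - a) * eval q x)
      ≡⟨ collapse (x - a) (eval q x) ⟩
    (x - a) * (x - a) * eval q x ∎
    where
    D q : List ℤ
    D = divideBy a p
    q = divideBy a D

    expand : ∀ x → eval p x ≡ eval p a + (x - a) * (eval D a + (x - a) * eval q x)
    expand x = trans (eval-divideBy a p x) (cong (λ t → eval p a + (x - a) * t) (eval-divideBy a D x))

    expand-at : ∀ M → eval p (a + M) ≡ eval p a + M * (eval D a + M * eval q (a + M))
    expand-at M = trans (expand (a + M)) (cong (λ y → eval p a + y * (eval D a + y * eval q (a + M))) (a+M-a≡M a M))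
      where
      a+M-a≡M : ∀ a M → a + M - a ≡ M
      a+M-a≡M = solve-∀

    p-root : eval p a ≡ 0ℤ
    p-root = divisible-by-all⇒≡0 λ m → let M = + suc m in
      ∣m+n∣n⇒∣m (subst (M ∣_) (expand-at M) (∣-trans (∣m⇒∣m*n M ∣-refl) (square∣ m)))
                (∣m⇒∣m*n _ ∣-refl)

    D-root : eval D a ≡ 0ℤ
    D-root = divisible-by-all⇒≡0 λ m → let M = + suc m in
      *-cancelˡ-∣ M (∣m+n∣n⇒∣m (subst (M * M ∣_) (p-at M) (square∣ m)) (∣m⇒∣m*n _ ∣-refl))
      where
      p-at : ∀ M → eval p (a + M) ≡ M * eval D a + M * M * eval q (a + M)
      p-at M = trans (expand-at M) (trans (cong (_+ M * (eval D a + M * eval q (a + M))) p-root) (distrib M _ _))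
        where
        distrib : ∀ M t u → 0ℤ + M * (t + M * u) ≡ M * t + M * M * u
        distrib = solve-∀

    collapse : ∀ y t → 0ℤ + y * (0ℤ + y * t) ≡ y * y * t
    collapse = solve-∀

  square-factor-shift⇔ : ∀ {f g} → Polynomial f → Polynomial g →
                         (∀ m → ∃[ r ] (f (suc (suc m)) ≡ g (suc m) ℕ.+ r × suc m ℕ.* suc m ∣ℕ r)) →
                         PolyDivides (λ x → (x - 1ℤ) * (x - 1ℤ)) f ⇔ PolyDivides (λ x → x * x) g
  square-factor-shift⇔ {f} {g} (p , f≡p) (s , g≡s) congruence = mk⇔ forward backward
    where
    module _ (m : ℕ) where
      M = + suc m

      f≡g+r : + f (suc (suc m)) ≡ + g (suc m) + + proj₁ (congruence m)
      f≡g+r = trans (cong +_ (proj₁ (proj₂ (congruence m)))) (pos-+ (g (suc m)) (proj₁ (congruence m)))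

      M²∣r : M * M ∣ + proj₁ (congruence m)
      M²∣r = subst (_∣ + proj₁ (congruence m)) (pos-* (suc m) (suc m)) (∣ᵤ⇒∣ (proj₂ (proj₂ (congruence m))))

    factor∣ : ∀ {d z} t → z ≡ d * t → d ∣ z
    factor∣ {d} t z≡dt = subst (d ∣_) (sym z≡dt) (∣m⇒∣m*n t ∣-refl)

    forward : PolyDivides (λ x → (x - 1ℤ) * (x - 1ℤ)) f → PolyDivides (λ x → x * x) g
    forward (q , f≡) = let (t , s≡) = double-root 0ℤ s M²∣s in
      t , λ k _ → trans (g≡s k) (trans (s≡ (+ k)) (cong (λ y → y * y * eval t (+ k)) (+-identityʳ (+ k))))
      where
      M²∣s : ∀ m → M m * M m ∣ eval s (0ℤ + M m)
      M²∣s m = subst (M m * M m ∣_) (g≡s (suc m))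
                     (∣m+n∣n⇒∣m (subst (M m * M m ∣_) (f≡g+r m) (factor∣ _ (f≡ (suc (suc m)) (s≤s z≤n)))) (M²∣r m))

    backward : PolyDivides (λ x → x * x) g → PolyDivides (λ x → (x - 1ℤ) * (x - 1ℤ)) f
    backward (q , g≡) = let (t , p≡) = double-root 1ℤ p M²∣p in t , λ k _ → trans (f≡p k) (p≡ (+ k))
      where
      M²∣p : ∀ m → M m * M m ∣ eval p (1ℤ + M m)
      M²∣p m = subst (M m * M m ∣_) (trans (sym (f≡g+r m)) (f≡p (suc (suc m))))
                     (∣m∣n⇒∣m+n (factor∣ _ (g≡ (suc m) (s≤s z≤n))) (M²∣r m))

open IntegerPolynomials

open import Data.Nat as ℕ using (zero; suc; _+_; _<_)
open import Data.Nat.Properties using (+-*-semiring; +-commutativeSemigroup; +-cancelˡ-≡; +-identityʳ; +-comm; +-assoc)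
open import Data.Nat.Divisibility using (_∣_; _∣0; ∣m∣n⇒∣m+n; m∣m*n; *-pres-∣; *-monoʳ-∣)
open import Data.Bool using (Bool; true; false; if_then_else_; _∧_; _∨_; not)
open import Data.Fin using (zero; suc; punchIn)
import Data.Fin as Fin
open import Data.Fin.Properties using (_≟_; any?; punchInᵢ≢i; punchIn-injective)
open import Data.Fin.Subset using (_⊈_; _─_; _∉_; Empty; Nonempty; ∣_∣)
open import Data.Fin.Subset.Properties
  using (_⊆?_; _∈?_; nonempty?; drop-∷-Empty; x∈p∧x∉q⇒x∈p─q; p─q⊆p; p∩q≢∅⇒∣p─q∣<∣p∣
        ; x∈p∩q⁺; x∈p∩q⁻; x∈p∪q⁺; x∈⁅x⁆; x∈⁅y⁆⇒x≡y)
open import Data.Maybe using (Maybe; just; nothing)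
import Data.Maybe as Maybe
open import Data.Maybe.Properties using (≡-dec; just-injective; map-injective)
open import Data.Vec using (Vec; []; _∷_; lookup; here; there; replicate)
open import Data.Vec.Properties using (lookup-replicate)
open import Data.Nat.Induction using (<-wellFounded)
open import Induction.WellFounded using (Acc; acc)
open import Data.List.Properties using (length-++; filter-++; map-tabulate; map-++; map-∘)
import Data.Nat.ListAction as List
open import Data.Nat.ListAction.Properties using (sum-++)
open import Relation.Nullary using (Dec; yes; no; does; ¬_)
open import Relation.Nullary.Decidable using (_×-dec_; _⊎-dec_; dec-false; does-⇔; decidable-stable; ¬?)
open import Relation.Unary using (Pred; Decidable)
open import Relation.Unary.Properties using (_∩?_; ∁?; U?)
open import Level using (0ℓ)
open import Data.List.Relation.Unary.All using ([]; _∷_; all?)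
import Data.List.Relation.Unary.All as All
open import Data.List.Membership.Propositional using () renaming (_∈_ to _∈ₗ_)
open import Data.List.Membership.Propositional.Properties using (∈-filter⁺)
open import Data.List.Relation.Unary.All.Properties using (all-filter; filter⁺)
open import Data.Sum using (inj₁; inj₂; [_,_])
open import Data.Product.Function.NonDependent.Propositional using (_×-⇔_)
import Function.Properties.Equivalence as ⇔
open import Data.Empty using (⊥-elim)
open import Algebra.Properties.CommutativeSemigroup +-commutativeSemigroup using () renaming (interchange to +-interchange)
open import Algebra.Properties.Semiring.Sum +-*-semiring
  using (sum; sum-syntax; sum-cong-≗; sum-remove; ∑-distrib-+; ∑-comm; sum-replicate-zero; *-distribˡ-sum; *-distribʳ-sum)

∑-const : ∀ k x → ∑[ i < k ] x ≡ k ℕ.* x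
∑-const zero    x = refl
∑-const (suc k) x = cong (x +_) (∑-const k x)

∑-if : ∀ {k} (b : Bool) (f : Fin k → ℕ) → ∑[ i < k ] (if b then f i else 0) ≡ (if b then sum f else 0)
∑-if {k} true  f = refl
∑-if {k} false f = sum-replicate-zero k

∑-δ : ∀ {k} (d : Fin k) (f : Fin k → ℕ) → ∑[ i < k ] (if does (i ≟ d) then f i else 0) ≡ f d
∑-δ {suc k} zero    f = trans (cong (f zero +_) (sum-replicate-zero k)) (+-identityʳ (f zero))
∑-δ {suc k} (suc d) f = ∑-δ d (f ∘ suc)

sumSubsets : ∀ n → (Subset n → ℕ) → ℕ
sumSubsets zero    f = f []
sumSubsets (suc n) f = sumSubsets n (f ∘ (false ∷_)) + sumSubsets n (f ∘ (true ∷_))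

sumSubsets-cong : ∀ n {f g : Subset n → ℕ} → (∀ C → f C ≡ g C) → sumSubsets n f ≡ sumSubsets n g
sumSubsets-cong zero    f≗g = f≗g []
sumSubsets-cong (suc n) f≗g =
  cong₂ _+_ (sumSubsets-cong n (f≗g ∘ (false ∷_))) (sumSubsets-cong n (f≗g ∘ (true ∷_)))

sumSubsets-zero : ∀ n → sumSubsets n (λ _ → 0) ≡ 0
sumSubsets-zero zero    = refl
sumSubsets-zero (suc n) = cong₂ _+_ (sumSubsets-zero n) (sumSubsets-zero n)

sumSubsets-∑ : ∀ n {k} (f : Subset n → Fin k → ℕ) →
               sumSubsets n (λ C → ∑[ i < k ] f C i) ≡ ∑[ i < k ] sumSubsets n (λ C → f C i)
sumSubsets-∑ zero    f = refl
sumSubsets-∑ (suc n) f =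
  trans (cong₂ _+_ (sumSubsets-∑ n (f ∘ (false ∷_))) (sumSubsets-∑ n (f ∘ (true ∷_))))
        (sym (∑-distrib-+ (λ i → sumSubsets n (λ C → f (false ∷ C) i)) (λ i → sumSubsets n (λ C → f (true ∷ C) i))))

sumSubsets-distrib-+ : ∀ n (f g : Subset n → ℕ) →
                       sumSubsets n (λ C → f C + g C) ≡ sumSubsets n f + sumSubsets n g
sumSubsets-distrib-+ zero    f g = refl
sumSubsets-distrib-+ (suc n) f g =
  trans (cong₂ _+_ (sumSubsets-distrib-+ n (f ∘ (false ∷_)) (g ∘ (false ∷_)))
                   (sumSubsets-distrib-+ n (f ∘ (true ∷_)) (g ∘ (true ∷_))))
        (+-interchange (sumSubsets n (f ∘ (false ∷_))) _ _ _)

sumSubsets-∣ : ∀ n {d} {f : Subset n → ℕ} → (∀ C → d ∣ f C) → d ∣ sumSubsets n f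
sumSubsets-∣ zero    d∣f = d∣f []
sumSubsets-∣ (suc n) d∣f = ∣m∣n⇒∣m+n (sumSubsets-∣ n (d∣f ∘ (false ∷_))) (sumSubsets-∣ n (d∣f ∘ (true ∷_)))

sum-map-subsets : ∀ n (f : Subset n → ℕ) → List.sum (map f (subsets n)) ≡ sumSubsets n f
sum-map-subsets zero    f = +-identityʳ (f [])
sum-map-subsets (suc n) f = begin
  List.sum (map f (map (false ∷_) (subsets n) ++ map (true ∷_) (subsets n)))
    ≡⟨ cong List.sum (map-++ f (map (false ∷_) (subsets n)) _) ⟩
  List.sum (map f (map (false ∷_) (subsets n)) ++ map f (map (true ∷_) (subsets n)))
    ≡⟨ sum-++ (map f (map (false ∷_) (subsets n))) _ ⟩
  List.sum (map f (map (false ∷_) (subsets n))) + List.sum (map f (map (true ∷_) (subsets n)))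
    ≡⟨ cong₂ _+_ (cong List.sum (sym (map-∘ (subsets n)))) (cong List.sum (sym (map-∘ (subsets n)))) ⟩
  List.sum (map (f ∘ (false ∷_)) (subsets n)) + List.sum (map (f ∘ (true ∷_)) (subsets n))
    ≡⟨ cong₂ _+_ (sum-map-subsets n _) (sum-map-subsets n _) ⟩
  sumSubsets (suc n) f ∎

sumWhere : ∀ {n} {Q : Pred (Subset n) 0ℓ} → Decidable Q → (Subset n → ℕ) → ℕ
sumWhere {n} Q? f = sumSubsets n (λ C → if does (Q? C) then f C else 0)

module _ {n : ℕ} {Q : Pred (Subset n) 0ℓ} (Q? : Decidable Q) where

  sumWhere-cong-⇔ : ∀ {R} (R? : Decidable R) (f : Subset n → ℕ) → (∀ C → Q C ⇔ R C) →
                    sumWhere Q? f ≡ sumWhere R? f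
  sumWhere-cong-⇔ R? f Q⇔R = sumSubsets-cong n λ C → cong (λ b → if b then f C else 0) (does-⇔ (Q⇔R C) (Q? C) (R? C))

  sumWhere-split : ∀ {R} (R? : Decidable R) (f : Subset n → ℕ) →
                   sumWhere Q? f ≡ sumWhere (Q? ∩? R?) f + sumWhere (Q? ∩? ∁? R?) f
  sumWhere-split R? f = trans (sumSubsets-cong n λ C → split (does (Q? C)) (does (R? C)) (f C))
                              (sumSubsets-distrib-+ n _ _)
    where
    split : ∀ a b x → (if a then x else 0) ≡ (if a ∧ b then x else 0) + (if a ∧ not b then x else 0)
    split false b     x = refl
    split true  true  x = sym (+-identityʳ x)
    split true  false x = refl

  sumWhere-if : ∀ {R} (R? : Decidable R) (f : Subset n → ℕ) →
                sumWhere Q? (λ C → if does (R? C) then f C else 0) ≡ sumWhere (Q? ∩? R?) f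
  sumWhere-if R? f = sumSubsets-cong n λ C → if-if (does (Q? C))
    where
    if-if : ∀ a {b x} → (if a then (if b then x else 0) else 0) ≡ (if a ∧ b then x else 0)
    if-if true  = refl
    if-if false = refl

  sumWhere-∣ : ∀ {d} (f : Subset n → ℕ) → (∀ {C} → Q C → d ∣ f C) → d ∣ sumWhere Q? f
  sumWhere-∣ f d∣f = sumSubsets-∣ n λ C → term C (Q? C)
    where
    term : ∀ C (q? : Dec (Q C)) → _ ∣ (if does q? then f C else 0)
    term C (yes q) = d∣f q
    term C (no _)  = _ ∣0

  sum-map-filter-subsets : (f : Subset n → ℕ) → List.sum (map f (filter Q? (subsets n))) ≡ sumWhere Q? f
  sum-map-filter-subsets f = trans (sum-map-filter (subsets n)) (sum-map-subsets n _)
    where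
    sum-map-filter : ∀ xs → List.sum (map f (filter Q? xs)) ≡ List.sum (map (λ C → if does (Q? C) then f C else 0) xs)
    sum-map-filter []       = refl
    sum-map-filter (C ∷ xs) with does (Q? C)
    ... | true  = cong (f C +_) (sum-map-filter xs)
    ... | false = sum-map-filter xs

Colouring : ℕ → ℕ → Set
Colouring n k = Vec (Maybe (Fin k)) n

count : ∀ {n} → Subset n → ∀ k {Q : Pred (Colouring n k) 0ℓ} → Decidable Q → ℕ
count []          k Q? = if does (Q? []) then 1 else 0
count (false ∷ W) k Q? = count W k (λ c → Q? (nothing ∷ c))
count (true ∷ W)  k Q? = ∑[ d < k ] count W k (λ c → Q? (just d ∷ c))

module _ {k : ℕ} where

  count-cong : ∀ {n} (W : Subset n) {Q R : Pred (Colouring n k) 0ℓ} (Q? : Decidable Q) (R? : Decidable R) →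
               (∀ c → Q c ⇔ R c) → count W k Q? ≡ count W k R?
  count-cong []          Q? R? Q⇔R = cong (λ b → if b then 1 else 0) (does-⇔ (Q⇔R []) (Q? []) (R? []))
  count-cong (false ∷ W) Q? R? Q⇔R = count-cong W _ _ (Q⇔R ∘ (nothing ∷_))
  count-cong (true ∷ W)  Q? R? Q⇔R = sum-cong-≗ λ d → count-cong W _ _ (Q⇔R ∘ (just d ∷_))

  count-none : ∀ {n} (W : Subset n) {Q : Pred (Colouring n k) 0ℓ} (Q? : Decidable Q) → (∀ c → ¬ Q c) → count W k Q? ≡ 0
  count-none []          Q? ¬Q = cong (λ b → if b then 1 else 0) (dec-false (Q? []) (¬Q []))
  count-none (false ∷ W) Q? ¬Q = count-none W _ (¬Q ∘ (nothing ∷_))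
  count-none (true ∷ W)  Q? ¬Q = trans (sum-cong-≗ λ d → count-none W _ (¬Q ∘ (just d ∷_))) (sum-replicate-zero k)

  count-∩-const : ∀ {n} (W : Subset n) {Q : Pred (Colouring n k) 0ℓ} (Q? : Decidable Q) {B} (B? : Dec B) →
                  count W k (Q? ∩? λ _ → B?) ≡ (if does B? then count W k Q? else 0)
  count-∩-const W Q? (yes b) = count-cong W _ Q? λ c → mk⇔ proj₁ (_, b)
  count-∩-const W Q? (no ¬b) = count-none W _ λ c → ¬b ∘ proj₂

  colour? : ∀ {n} (v : Fin n) (d : Fin k) → Decidable (λ (c : Colouring n k) → lookup c v ≡ just d)
  colour? v d c = ≡-dec _≟_ (lookup c v) (just d)

  count-by-colour : ∀ {n} (W : Subset n) {v} → v ∈ W → {Q : Pred (Colouring n k) 0ℓ} (Q? : Decidable Q) →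
                    count W k Q? ≡ ∑[ d < k ] count W k (Q? ∩? colour? v d)
  count-by-colour (true ∷ W) here Q? = sym (trans
    (sum-cong-≗ λ d → sum-cong-≗ λ e → count-∩-const W (λ c → Q? (just e ∷ c)) (≡-dec _≟_ (just e) (just d)))
    (sum-cong-≗ λ d → ∑-δ d λ e → count W k (λ c → Q? (just e ∷ c))))
  count-by-colour (false ∷ W) (there v∈W) Q? = count-by-colour W v∈W _
  count-by-colour (true ∷ W)  (there {i = v} v∈W) Q? =
    trans (sum-cong-≗ λ e → count-by-colour W v∈W (λ c → Q? (just e ∷ c)))
          (∑-comm λ e d → count W k (λ c → Q? (just e ∷ c) ×-dec colour? v d c))

addClass : ∀ {n k} → Fin (suc k) → Subset n → Colouring n k → Colouring n (suc k)
addClass d []          []      = []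
addClass d (true ∷ C)  (_ ∷ c) = just d ∷ addClass d C c
addClass d (false ∷ C) (x ∷ c) = Maybe.map (punchIn d) x ∷ addClass d C c

count-colourClasses : ∀ {n k} (d : Fin (suc k)) (W : Subset n) {Q : Pred (Colouring n (suc k)) 0ℓ} (Q? : Decidable Q) →
                      count W (suc k) Q? ≡ sumWhere (_⊆? W) (λ C → count (W ─ C) k (λ c → Q? (addClass d C c)))
count-colourClasses d []          Q? = refl
count-colourClasses {suc n} d (false ∷ W) Q? = begin
  count W _ (λ c → Q? (nothing ∷ c))
    ≡⟨ count-colourClasses d W _ ⟩
  sumWhere (_⊆? W) (λ C → count (W ─ C) _ (λ c → Q? (nothing ∷ addClass d C c)))
    ≡⟨ sym (+-identityʳ _) ⟩
  sumWhere (_⊆? W) (λ C → count (W ─ C) _ (λ c → Q? (nothing ∷ addClass d C c))) + 0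
    ≡⟨ cong (sumWhere (_⊆? W) (λ C → count (W ─ C) _ (λ c → Q? (nothing ∷ addClass d C c))) +_) (sym (sumSubsets-zero n)) ⟩
  sumWhere (_⊆? (false ∷ W)) (λ C → count ((false ∷ W) ─ C) _ (λ c → Q? (addClass d C c))) ∎
count-colourClasses {suc n} {k} d (true ∷ W) Q? = begin
  ∑[ e < suc k ] class e
    ≡⟨ sum-remove {i = d} class ⟩
  class d + ∑[ e < k ] class (punchIn d e)
    ≡⟨ cong₂ _+_ (count-colourClasses d W _) (sum-cong-≗ λ e → count-colourClasses d W (λ c → Q? (just (punchIn d e) ∷ c))) ⟩
  sumWhere (_⊆? W) (λ C → rest C d) + ∑[ e < k ] sumWhere (_⊆? W) (λ C → rest C (punchIn d e))
    ≡⟨ cong (sumWhere (_⊆? W) (λ C → rest C d) +_)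
            (sym (sumSubsets-∑ n λ C e → if does (C ⊆? W) then rest C (punchIn d e) else 0)) ⟩
  sumWhere (_⊆? W) (λ C → rest C d) + sumSubsets n (λ C → ∑[ e < k ] (if does (C ⊆? W) then rest C (punchIn d e) else 0))
    ≡⟨ cong (sumWhere (_⊆? W) (λ C → rest C d) +_) (sumSubsets-cong n λ C → ∑-if (does (C ⊆? W)) (rest C ∘ punchIn d)) ⟩
  sumWhere (_⊆? W) (λ C → rest C d) + sumWhere (_⊆? W) (λ C → ∑[ e < k ] rest C (punchIn d e))
    ≡⟨ +-comm (sumWhere (_⊆? W) (λ C → rest C d)) _ ⟩
  sumWhere (_⊆? (true ∷ W)) (λ C → count ((true ∷ W) ─ C) k (λ c → Q? (addClass d C c))) ∎
  where
  class : Fin (suc k) → ℕ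
  class e = count W (suc k) (λ c → Q? (just e ∷ c))
  rest : Subset n → Fin (suc k) → ℕ
  rest C e = count (W ─ C) k (λ c → Q? (just e ∷ addClass d C c))

restrict : ∀ {n k} → Subset n → Colouring n k → Colouring n k
restrict []          []      = []
restrict (true ∷ U)  (x ∷ c) = x ∷ restrict U c
restrict (false ∷ U) (_ ∷ c) = nothing ∷ restrict U c

count-∪ : ∀ {n k} (U₁ U₂ : Subset n) → Empty (U₁ ∩ U₂) →
          {Q₁ Q₂ : Pred (Colouring n k) 0ℓ} (Q₁? : Decidable Q₁) (Q₂? : Decidable Q₂) →
          count (U₁ ∪ U₂) k (λ c → Q₁? (restrict U₁ c) ×-dec Q₂? (restrict U₂ c)) ≡ count U₁ k Q₁? ℕ.* count U₂ k Q₂?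
count-∪ []          []          _ Q₁? Q₂? = indicator-∧ (does (Q₁? [])) (does (Q₂? []))
  where
  indicator-∧ : ∀ a b → (if a ∧ b then 1 else 0) ≡ (if a then 1 else 0) ℕ.* (if b then 1 else 0)
  indicator-∧ true  true  = refl
  indicator-∧ true  false = refl
  indicator-∧ false b     = refl
count-∪ (false ∷ U₁) (false ∷ U₂) ∅ Q₁? Q₂? = count-∪ U₁ U₂ (drop-∷-Empty ∅) _ _
count-∪ {k = k} (true ∷ U₁) (false ∷ U₂) ∅ Q₁? Q₂? = begin
  ∑[ d < k ] count (U₁ ∪ U₂) k (λ c → Q₁? (just d ∷ restrict U₁ c) ×-dec Q₂? (nothing ∷ restrict U₂ c))
    ≡⟨ sum-cong-≗ (λ d → count-∪ U₁ U₂ (drop-∷-Empty ∅) (λ c → Q₁? (just d ∷ c)) (λ c → Q₂? (nothing ∷ c))) ⟩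
  ∑[ d < k ] (count U₁ k (λ c → Q₁? (just d ∷ c)) ℕ.* count U₂ k (λ c → Q₂? (nothing ∷ c)))
    ≡⟨ sym (*-distribʳ-sum (count U₂ k (λ c → Q₂? (nothing ∷ c))) (λ d → count U₁ k (λ c → Q₁? (just d ∷ c)))) ⟩
  ∑[ d < k ] count U₁ k (λ c → Q₁? (just d ∷ c)) ℕ.* count U₂ k (λ c → Q₂? (nothing ∷ c)) ∎
count-∪ {k = k} (false ∷ U₁) (true ∷ U₂) ∅ Q₁? Q₂? = begin
  ∑[ d < k ] count (U₁ ∪ U₂) k (λ c → Q₁? (nothing ∷ restrict U₁ c) ×-dec Q₂? (just d ∷ restrict U₂ c))
    ≡⟨ sum-cong-≗ (λ d → count-∪ U₁ U₂ (drop-∷-Empty ∅) (λ c → Q₁? (nothing ∷ c)) (λ c → Q₂? (just d ∷ c))) ⟩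
  ∑[ d < k ] (count U₁ k (λ c → Q₁? (nothing ∷ c)) ℕ.* count U₂ k (λ c → Q₂? (just d ∷ c)))
    ≡⟨ sym (*-distribˡ-sum (count U₁ k (λ c → Q₁? (nothing ∷ c))) (λ d → count U₂ k (λ c → Q₂? (just d ∷ c)))) ⟩
  count U₁ k (λ c → Q₁? (nothing ∷ c)) ℕ.* ∑[ d < k ] count U₂ k (λ c → Q₂? (just d ∷ c)) ∎
count-∪ (true ∷ U₁) (true ∷ U₂) ∅ _ _ = ⊥-elim (∅ (zero , here))

count-no-colours : ∀ {n} (W : Subset n) → Nonempty W → {Q : Pred (Colouring n 0) 0ℓ} (Q? : Decidable Q) → count W 0 Q? ≡ 0
count-no-colours (true ∷ W)  (zero , here)          Q? = refl
count-no-colours (true ∷ W)  (suc v , there v∈W)    Q? = refl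
count-no-colours (false ∷ W) (suc v , there v∈W)    Q? = count-no-colours W (v , v∈W) _

count-no-vertices : ∀ {n k} (W : Subset n) → Empty W → {Q : Pred (Colouring n k) 0ℓ} (Q? : Decidable Q) →
                    count W k Q? ≡ (if does (Q? (replicate n nothing)) then 1 else 0)
count-no-vertices []          ∅ Q? = refl
count-no-vertices (true ∷ W)  ∅ Q? = ⊥-elim (∅ (zero , here))
count-no-vertices (false ∷ W) ∅ Q? = count-no-vertices W (drop-∷-Empty ∅) _

private
  inColour : ∀ {n} (W : Subset n) k → Fin k → List (Colouring (suc n) k)
  inColour W k d = map (just d ∷_) (colourings W k)

  -- `colourings` enumerates the colours by a list local to its definition; abstracting the
  -- number of colours with `with` lets unification name that list.
  record ColourList {n} (W : Subset n) (F : ℕ → (m : ℕ) → List (Fin m)) : Set where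
    field
      unfold : ∀ j → colourings (true ∷ W) (suc j) ≡ concatMap (inColour W (suc j)) (zero ∷ map suc (F (suc j) j))

  colourList : ∀ {n} (W : Subset n) → ColourList W _
  ColourList.unfold (colourList W) j with suc j | Fin.zero {j} | Fin.suc {j}
  ... | o | z | s with map {A = Fin j} {B = Fin o} s
  ... | _ = refl

  listOf : ∀ {n} {W : Subset n} {F} → ColourList W F → ℕ → (m : ℕ) → List (Fin m)
  listOf {F = F} _ = F

  allFin-unique : (F : (m : ℕ) → List (Fin m)) → F 0 ≡ [] → (∀ m → F (suc m) ≡ zero ∷ map suc (F m)) →
                  ∀ m → F m ≡ allFin m
  allFin-unique F F0 Fsuc zero    = F0
  allFin-unique F F0 Fsuc (suc m) =
    trans (Fsuc m) (cong (zero ∷_) (trans (cong (map suc) (allFin-unique F F0 Fsuc m)) (map-tabulate id suc)))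

colourings-inside : ∀ {n} (W : Subset n) k → colourings (true ∷ W) k ≡ concatMap (inColour W k) (allFin k)
colourings-inside W k = cong (concatMap (inColour W k)) (allFin-unique (listOf (colourList W) k) refl (λ _ → refl) k)

module _ {B : Set} {Q : Pred B 0ℓ} (Q? : Decidable Q) where

  length-filter-map : ∀ {A : Set} (f : A → B) (xs : List A) → length (filter Q? (map f xs)) ≡ length (filter (Q? ∘ f) xs)
  length-filter-map f []       = refl
  length-filter-map f (x ∷ xs) with does (Q? (f x))
  ... | true  = cong suc (length-filter-map f xs)
  ... | false = length-filter-map f xs

  length-filter-concatMap : ∀ {A : Set} {k} (g : A → List B) (h : Fin k → A) →
                            length (filter Q? (concatMap g (tabulate h))) ≡ ∑[ i < k ] length (filter Q? (g (h i)))
  length-filter-concatMap {k = zero}  g h = refl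
  length-filter-concatMap {k = suc k} g h = begin
    length (filter Q? (g (h zero) ++ concatMap g (tabulate (h ∘ suc))))
      ≡⟨ cong length (filter-++ Q? (g (h zero)) _) ⟩
    length (filter Q? (g (h zero)) ++ filter Q? (concatMap g (tabulate (h ∘ suc))))
      ≡⟨ length-++ (filter Q? (g (h zero))) ⟩
    length (filter Q? (g (h zero))) + length (filter Q? (concatMap g (tabulate (h ∘ suc))))
      ≡⟨ cong (length (filter Q? (g (h zero))) +_) (length-filter-concatMap g (h ∘ suc)) ⟩
    ∑[ i < suc k ] length (filter Q? (g (h i))) ∎

length-filter-colourings : ∀ {n} (W : Subset n) k {Q : Pred (Colouring n k) 0ℓ} (Q? : Decidable Q) →
                           length (filter Q? (colourings W k)) ≡ count W k Q?
length-filter-colourings []          k Q? with does (Q? [])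
... | true  = refl
... | false = refl
length-filter-colourings (false ∷ W) k Q? =
  trans (length-filter-map Q? (nothing ∷_) (colourings W k)) (length-filter-colourings W k _)
length-filter-colourings (true ∷ W)  k Q? = begin
  length (filter Q? (colourings (true ∷ W) k))
    ≡⟨ cong (length ∘ filter Q?) (colourings-inside W k) ⟩
  length (filter Q? (concatMap (inColour W k) (allFin k)))
    ≡⟨ length-filter-concatMap Q? (inColour W k) id ⟩
  ∑[ d < k ] length (filter Q? (inColour W k d))
    ≡⟨ sum-cong-≗ (λ d → trans (length-filter-map Q? (just d ∷_) (colourings W k)) (length-filter-colourings W k _)) ⟩
  count (true ∷ W) k Q? ∎

⊈-witness : ∀ {n} {p q : Subset n} → p ⊈ q → ∃[ x ] (x ∈ p × x ∉ q)
⊈-witness {p = p} {q} p⊈q with any? (λ x → (x ∈? p) ×-dec ¬? (x ∈? q))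
... | yes witness = witness
... | no  none    = ⊥-elim (p⊈q λ {x} x∈p → decidable-stable (x ∈? q) λ x∉q → none (x , x∈p , x∉q))

x∈p─q⇒x∉q : ∀ {n} (p q : Subset n) {x} → x ∈ p ─ q → x ∉ q
x∈p─q⇒x∉q (true ∷ p) (false ∷ q) here         ()
x∈p─q⇒x∉q (_ ∷ p)    (_ ∷ q)     (there x∈p─q) (there x∈q) = x∈p─q⇒x∉q p q x∈p─q x∈q

─-distribʳ-∪ : ∀ {n} (p q r : Subset n) → (p ∪ q) ─ r ≡ (p ─ r) ∪ (q ─ r)
─-distribʳ-∪ []      []      []          = refl
─-distribʳ-∪ (x ∷ p) (y ∷ q) (true ∷ r)  = cong (false ∷_) (─-distribʳ-∪ p q r)
─-distribʳ-∪ (x ∷ p) (y ∷ q) (false ∷ r) = cong ((x ∨ y) ∷_) (─-distribʳ-∪ p q r)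

module _ {k : ℕ} (d : Fin (suc k)) where

  lookup-addClass-∈ : ∀ {n} {C : Subset n} (c : Colouring n k) {x} → x ∈ C → lookup (addClass d C c) x ≡ just d
  lookup-addClass-∈ {C = true ∷ C}  (_ ∷ c) here        = refl
  lookup-addClass-∈ {C = true ∷ C}  (_ ∷ c) (there x∈C) = lookup-addClass-∈ c x∈C
  lookup-addClass-∈ {C = false ∷ C} (_ ∷ c) (there x∈C) = lookup-addClass-∈ c x∈C

  lookup-addClass-∉ : ∀ {n} {C : Subset n} (c : Colouring n k) {x} → x ∉ C →
                      lookup (addClass d C c) x ≡ Maybe.map (punchIn d) (lookup c x)
  lookup-addClass-∉ {C = true ∷ C}  (_ ∷ c) {zero}  x∉C = ⊥-elim (x∉C here)
  lookup-addClass-∉ {C = false ∷ C} (_ ∷ c) {zero}  x∉C = refl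
  lookup-addClass-∉ {C = true ∷ C}  (_ ∷ c) {suc x} x∉C = lookup-addClass-∉ c (x∉C ∘ there)
  lookup-addClass-∉ {C = false ∷ C} (_ ∷ c) {suc x} x∉C = lookup-addClass-∉ c (x∉C ∘ there)

  private
    map-punchIn≢ : ∀ (y : Maybe (Fin k)) → Maybe.map (punchIn d) y ≢ just d
    map-punchIn≢ (just y) eq = punchInᵢ≢i d y (just-injective eq)

  addClass-colour : ∀ {n} {C : Subset n} (c : Colouring n k) x → lookup (addClass d C c) x ≡ just d ⇔ x ∈ C
  addClass-colour {C = C} c x with x ∈? C
  ... | yes x∈C = mk⇔ (λ _ → x∈C) (λ _ → lookup-addClass-∈ c x∈C)
  ... | no  x∉C = mk⇔ (λ eq → ⊥-elim (map-punchIn≢ (lookup c x) (trans (sym (lookup-addClass-∉ c x∉C)) eq)))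
                      (λ x∈C → ⊥-elim (x∉C x∈C))

  nonMono-addClass : ∀ {n} {W C e : Subset n} (c : Colouring n k) → e ⊆ W →
                     NonMono (addClass d C c) e ⇔ (e ⊈ C × (e ⊆ W ─ C → NonMono c e))
  nonMono-addClass {W = W} {C} {e} c e⊆W = mk⇔ to from
    where
    outside : e ⊆ W ─ C → ∀ {x} → x ∈ e → lookup (addClass d C c) x ≡ Maybe.map (punchIn d) (lookup c x)
    outside e⊆W─C x∈e = lookup-addClass-∉ c (x∈p─q⇒x∉q W C (e⊆W─C x∈e))

    to : NonMono (addClass d C c) e → e ⊈ C × (e ⊆ W ─ C → NonMono c e)
    to (i , j , i∈e , j∈e , i≢j) =
      (λ e⊆C → i≢j (trans (lookup-addClass-∈ c (e⊆C i∈e)) (sym (lookup-addClass-∈ c (e⊆C j∈e))))) ,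
      (λ e⊆W─C → i , j , i∈e , j∈e , λ eq →
        i≢j (trans (outside e⊆W─C i∈e) (trans (cong (Maybe.map (punchIn d)) eq) (sym (outside e⊆W─C j∈e)))))

    from : e ⊈ C × (e ⊆ W ─ C → NonMono c e) → NonMono (addClass d C c) e
    from (e⊈C , nonMono) with e ⊆? W ─ C
    ... | yes e⊆W─C =
      let (i , j , i∈e , j∈e , i≢j) = nonMono e⊆W─C in
      i , j , i∈e , j∈e , λ eq →
        i≢j (map-injective (punchIn-injective d _ _) (trans (sym (outside e⊆W─C i∈e)) (trans eq (outside e⊆W─C j∈e))))
    ... | no  e⊈W─C =
      let (i , i∈e , i∉C) = ⊈-witness e⊈C
          (j , j∈e , j∉W─C) = ⊈-witness e⊈W─C
          j∈C = decidable-stable (j ∈? C) λ j∉C → j∉W─C (x∈p∧x∉q⇒x∈p─q (e⊆W j∈e) j∉C)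
      in i , j , i∈e , j∈e , λ eq →
        map-punchIn≢ (lookup c i) (trans (sym (lookup-addClass-∉ c i∉C)) (trans eq (lookup-addClass-∈ c j∈C)))

EdgesInside : ∀ {n} → Hypergraph n → Set
EdgesInside H = All (_⊆ V H) (E H)

proper? : ∀ {n k} (H : Hypergraph n) → Decidable (Proper {k = k} H)
proper? H c = all? (nonMono? c) (E H)

independent? : ∀ {n} (H : Hypergraph n) → Decidable (Independent H)
independent? H = (_⊆? V H) ∩? λ C → all? (λ e → ¬? (e ⊆? C)) (E H)

P≡count : ∀ {n} (H : Hypergraph n) k → P H k ≡ count (V H) k (proper? H)
P≡count H k = length-filter-colourings (V H) k (proper? H)

induced : ∀ {n} → Hypergraph n → Subset n → Hypergraph n
induced H U = hypergraph U (filter (_⊆? U) (E H))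

edgesInside-induced : ∀ {n} (H : Hypergraph n) U → EdgesInside (induced H U)
edgesInside-induced H U = all-filter (_⊆? U) (E H)

proper-addClass : ∀ {n k} (H : Hypergraph n) → EdgesInside H → (d : Fin (suc k)) (C : Subset n) (c : Colouring n k) →
                  Proper H (addClass d C c) ⇔ (All (_⊈ C) (E H) × Proper (H ∖ᴴ C) c)
proper-addClass H inside d C c = go (E H) inside
  where
  open Equivalence
  go : ∀ es → All (_⊆ V H) es →
       All (NonMono (addClass d C c)) es ⇔ (All (_⊈ C) es × All (NonMono c) (filter (_⊆? V H ─ C) es))
  go []       []            = mk⇔ (λ _ → [] , []) (λ _ → [])
  go (e ∷ es) (e⊆V ∷ es⊆V) with e ⊆? V H ─ C | nonMono-addClass d c e⊆V | go es es⊆V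
  ... | yes e⊆V─C | edge | rest = mk⇔
    (λ { (ne ∷ nes) → let (e⊈C , nm) = to edge ne ; (⊈s , nms) = to rest nes in (e⊈C ∷ ⊈s) , (nm e⊆V─C ∷ nms) })
    (λ { (e⊈C ∷ ⊈s , nm ∷ nms) → from edge (e⊈C , λ _ → nm) ∷ from rest (⊈s , nms) })
  ... | no  e⊈V─C | edge | rest = mk⇔
    (λ { (ne ∷ nes) → let (⊈s , nms) = to rest nes in (proj₁ (to edge ne) ∷ ⊈s) , nms })
    (λ { (e⊈C ∷ ⊈s , nms) → from edge (e⊈C , ⊥-elim ∘ e⊈V─C) ∷ from rest (⊈s , nms) })

module _ {n : ℕ} (H : Hypergraph n) (inside : EdgesInside H) where

  P-suc-colourClasses : ∀ {k} (d : Fin (suc k)) {g : Pred (Colouring n (suc k)) 0ℓ} (g? : Decidable g)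
                        {G : Pred (Subset n) 0ℓ} (G? : Decidable G) → (∀ C c → g (addClass d C c) ⇔ G C) →
                        count (V H) (suc k) (proper? H ∩? g?) ≡ sumWhere (independent? H ∩? G?) (λ C → P (H ∖ᴴ C) k)
  P-suc-colourClasses {k} d g? G? g⇔G = begin
    count (V H) (suc k) (proper? H ∩? g?)
      ≡⟨ count-colourClasses d (V H) _ ⟩
    sumWhere (_⊆? V H) (λ C → count (V H ─ C) k (λ c → (proper? H ∩? g?) (addClass d C c)))
      ≡⟨ sumSubsets-cong n (λ C → cong (λ m → if does (C ⊆? V H) then m else 0) (restricted C)) ⟩
    sumWhere (_⊆? V H) (λ C → if does (edgeFree? C ×-dec G? C) then P (H ∖ᴴ C) k else 0)
      ≡⟨ sumWhere-if (_⊆? V H) (λ C → edgeFree? C ×-dec G? C) (λ C → P (H ∖ᴴ C) k) ⟩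
    sumWhere ((_⊆? V H) ∩? λ C → edgeFree? C ×-dec G? C) (λ C → P (H ∖ᴴ C) k)
      ≡⟨ sumWhere-cong-⇔ ((_⊆? V H) ∩? λ C → edgeFree? C ×-dec G? C) (independent? H ∩? G?) (λ C → P (H ∖ᴴ C) k)
           (λ C → mk⇔ (λ (s , f , g) → (s , f) , g) (λ ((s , f) , g) → s , f , g)) ⟩
    sumWhere (independent? H ∩? G?) (λ C → P (H ∖ᴴ C) k) ∎
    where
    edgeFree? : Decidable (λ C → All (_⊈ C) (E H))
    edgeFree? C = all? (λ e → ¬? (e ⊆? C)) (E H)

    restricted : ∀ C → count (V H ─ C) k (λ c → (proper? H ∩? g?) (addClass d C c))
                     ≡ (if does (edgeFree? C ×-dec G? C) then P (H ∖ᴴ C) k else 0)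
    restricted C = begin
      count (V H ─ C) k (λ c → (proper? H ∩? g?) (addClass d C c))
        ≡⟨ count-cong (V H ─ C) _ (proper? (H ∖ᴴ C) ∩? λ _ → edgeFree? C ×-dec G? C) (λ c →
             let open Equivalence (proper-addClass H inside d C c) in
             mk⇔ (λ (p , q) → let (f , p′) = to p in p′ , f , Equivalence.to (g⇔G C c) q)
                 (λ (p′ , f , q) → from (f , p′) , Equivalence.from (g⇔G C c) q)) ⟩
      count (V H ─ C) k (proper? (H ∖ᴴ C) ∩? λ _ → edgeFree? C ×-dec G? C)
        ≡⟨ count-∩-const (V H ─ C) (proper? (H ∖ᴴ C)) (edgeFree? C ×-dec G? C) ⟩
      (if does (edgeFree? C ×-dec G? C) then count (V H ─ C) k (proper? (H ∖ᴴ C)) else 0)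
        ≡⟨ cong (λ m → if does (edgeFree? C ×-dec G? C) then m else 0) (sym (P≡count (H ∖ᴴ C) k)) ⟩
      (if does (edgeFree? C ×-dec G? C) then P (H ∖ᴴ C) k else 0) ∎

  P-suc : ∀ k → P H (suc k) ≡ sumWhere (independent? H) (λ C → P (H ∖ᴴ C) k)
  P-suc k = begin
    P H (suc k)
      ≡⟨ P≡count H (suc k) ⟩
    count (V H) (suc k) (proper? H)
      ≡⟨ count-cong (V H) (proper? H) (proper? H ∩? U?) (λ c → mk⇔ (_, _) proj₁) ⟩
    count (V H) (suc k) (proper? H ∩? U?)
      ≡⟨ P-suc-colourClasses zero U? U? (λ C c → mk⇔ _ _) ⟩
    sumWhere (independent? H ∩? U?) (λ C → P (H ∖ᴴ C) k)
      ≡⟨ sumWhere-cong-⇔ (independent? H ∩? U?) (independent? H) (λ C → P (H ∖ᴴ C) k) (λ C → mk⇔ proj₁ (_, _)) ⟩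
    sumWhere (independent? H) (λ C → P (H ∖ᴴ C) k) ∎

  P-suc-vertex : ∀ {v} → v ∈ V H → ∀ k →
                 P H (suc k) ≡ suc k ℕ.* sumWhere (independent? H ∩? (v ∈?_)) (λ C → P (H ∖ᴴ C) k)
  P-suc-vertex {v} v∈V k = begin
    P H (suc k)
      ≡⟨ P≡count H (suc k) ⟩
    count (V H) (suc k) (proper? H)
      ≡⟨ count-by-colour (V H) v∈V (proper? H) ⟩
    ∑[ d < suc k ] count (V H) (suc k) (proper? H ∩? colour? v d)
      ≡⟨ sum-cong-≗ (λ d → P-suc-colourClasses d (colour? v d) (v ∈?_) (λ C c → addClass-colour d c v)) ⟩
    ∑[ d < suc k ] sumWhere (independent? H ∩? (v ∈?_)) (λ C → P (H ∖ᴴ C) k)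
      ≡⟨ ∑-const (suc k) _ ⟩
    suc k ℕ.* sumWhere (independent? H ∩? (v ∈?_)) (λ C → P (H ∖ᴴ C) k) ∎

  sumWhere-independent-∌ : ∀ {v} → v ∈ V H → ∀ k →
                           sumWhere (independent? H ∩? ∁? (v ∈?_)) (λ C → P (H ∖ᴴ C) k)
                           ≡ k ℕ.* sumWhere (independent? H ∩? (v ∈?_)) (λ C → P (H ∖ᴴ C) k)
  sumWhere-independent-∌ {v} v∈V k = +-cancelˡ-≡ (containing) _ _ (begin
    containing + sumWhere (independent? H ∩? ∁? (v ∈?_)) (λ C → P (H ∖ᴴ C) k)
      ≡⟨ sym (sumWhere-split (independent? H) (v ∈?_) (λ C → P (H ∖ᴴ C) k)) ⟩
    sumWhere (independent? H) (λ C → P (H ∖ᴴ C) k)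
      ≡⟨ sym (P-suc k) ⟩
    P H (suc k)
      ≡⟨ P-suc-vertex v∈V k ⟩
    containing + k ℕ.* containing ∎)
    where containing = sumWhere (independent? H ∩? (v ∈?_)) (λ C → P (H ∖ᴴ C) k)

  suc∣P-suc : Nonempty (V H) → ∀ k → suc k ∣ P H (suc k)
  suc∣P-suc (v , v∈V) k = subst (suc k ∣_) (sym (P-suc-vertex v∈V k)) (m∣m*n _)

  independent⇒Nonempty-─ : ∀ {C e} → Independent H C → e ∈ₗ E H → Nonempty (V H ─ C)
  independent⇒Nonempty-─ (_ , edgeFree) e∈E =
    let (x , x∈e , x∉C) = ⊈-witness (All.lookup edgeFree e∈E) in
    x , x∈p∧x∉q⇒x∈p─q (All.lookup inside e∈E x∈e) x∉C

lookup-restrict : ∀ {n k} {U : Subset n} (c : Colouring n k) {x} → x ∈ U → lookup (restrict U c) x ≡ lookup c x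
lookup-restrict {U = true ∷ U}  (_ ∷ c) here        = refl
lookup-restrict {U = true ∷ U}  (_ ∷ c) (there x∈U) = lookup-restrict c x∈U
lookup-restrict {U = false ∷ U} (_ ∷ c) (there x∈U) = lookup-restrict c x∈U

nonMono-restrict : ∀ {n k} {U e : Subset n} (c : Colouring n k) → e ⊆ U → NonMono (restrict U c) e ⇔ NonMono c e
nonMono-restrict c e⊆U = mk⇔
  (λ (i , j , i∈e , j∈e , i≢j) → i , j , i∈e , j∈e , λ eq →
    i≢j (trans (lookup-restrict c (e⊆U i∈e)) (trans eq (sym (lookup-restrict c (e⊆U j∈e))))))
  (λ (i , j , i∈e , j∈e , i≢j) → i , j , i∈e , j∈e , λ eq →
    i≢j (trans (sym (lookup-restrict c (e⊆U i∈e))) (trans eq (lookup-restrict c (e⊆U j∈e)))))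

All-filter-cover : ∀ {A : Set} {P₁ P₂ Q : Pred A 0ℓ} (P₁? : Decidable P₁) (P₂? : Decidable P₂) {xs : List A} →
                   All (λ x → P₁ x ⊎ P₂ x) xs → All Q xs ⇔ (All Q (filter P₁? xs) × All Q (filter P₂? xs))
All-filter-cover P₁? P₂? cover = mk⇔
  (λ qs → filter⁺ P₁? qs , filter⁺ P₂? qs)
  (λ (qs₁ , qs₂) → All.tabulate λ x∈xs →
    [ All.lookup qs₁ ∘ ∈-filter⁺ P₁? x∈xs , All.lookup qs₂ ∘ ∈-filter⁺ P₂? x∈xs ] (All.lookup cover x∈xs))

proper-induced : ∀ {n k} (H : Hypergraph n) (U : Subset n) (c : Colouring n k) →
                 Proper (induced H U) (restrict U c) ⇔ All (NonMono c) (filter (_⊆? U) (E H))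
proper-induced H U c = mk⇔ (λ qs → All.zipWith toWhole (all-filter (_⊆? U) (E H) , qs))
                            (λ qs → All.zipWith toPart (all-filter (_⊆? U) (E H) , qs))
  where
  toWhole : ∀ {e} → e ⊆ U × NonMono (restrict U c) e → NonMono c e
  toWhole (e⊆U , q) = Equivalence.to (nonMono-restrict c e⊆U) q
  toPart : ∀ {e} → e ⊆ U × NonMono c e → NonMono (restrict U c) e
  toPart (e⊆U , q) = Equivalence.from (nonMono-restrict c e⊆U) q

P-induced-∪ : ∀ {n} (H : Hypergraph n) (U₁ U₂ : Subset n) → V H ≡ U₁ ∪ U₂ → Empty (U₁ ∩ U₂) →
              All (λ e → e ⊆ U₁ ⊎ e ⊆ U₂) (E H) → ∀ k → P H k ≡ P (induced H U₁) k ℕ.* P (induced H U₂) k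
P-induced-∪ H U₁ U₂ V≡U₁∪U₂ disjoint cover k = begin
  P H k
    ≡⟨ P≡count H k ⟩
  count (V H) k (proper? H)
    ≡⟨ cong (λ W → count W k (proper? H)) V≡U₁∪U₂ ⟩
  count (U₁ ∪ U₂) k (proper? H)
    ≡⟨ count-cong (U₁ ∪ U₂) (proper? H) _ (λ c →
         ⇔.trans (All-filter-cover (_⊆? U₁) (_⊆? U₂) cover) (⇔.sym (proper-induced H U₁ c ×-⇔ proper-induced H U₂ c))) ⟩
  count (U₁ ∪ U₂) k (λ c → proper? (induced H U₁) (restrict U₁ c) ×-dec proper? (induced H U₂) (restrict U₂ c))
    ≡⟨ count-∪ U₁ U₂ disjoint (proper? (induced H U₁)) (proper? (induced H U₂)) ⟩
  count U₁ k (proper? (induced H U₁)) ℕ.* count U₂ k (proper? (induced H U₂))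
    ≡⟨ sym (cong₂ ℕ._*_ (P≡count (induced H U₁) k) (P≡count (induced H U₂) k)) ⟩
  P (induced H U₁) k ℕ.* P (induced H U₂) k ∎

P-no-vertices : ∀ {n} (H : Hypergraph n) → Empty (V H) → ∀ k → P H k ≡ P H 0
P-no-vertices {n} H ∅ k = begin
  P H k
    ≡⟨ trans (P≡count H k) (count-no-vertices (V H) ∅ (proper? H)) ⟩
  (if does (proper? {k = k} H (replicate n nothing)) then 1 else 0)
    ≡⟨ cong (λ b → if b then 1 else 0) (does-⇔ (mk⇔ (All.map (⊥-elim ∘ monochrome)) (All.map (⊥-elim ∘ monochrome)))
                                                (proper? H (replicate n nothing)) (proper? H (replicate n nothing))) ⟩
  (if does (proper? {k = 0} H (replicate n nothing)) then 1 else 0)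
    ≡⟨ sym (trans (P≡count H 0) (count-no-vertices (V H) ∅ (proper? H))) ⟩
  P H 0 ∎
  where
  monochrome : ∀ {k e} → ¬ NonMono {k = k} (replicate n nothing) e
  monochrome (i , j , _ , _ , i≢j) = i≢j (trans (lookup-replicate i nothing) (sym (lookup-replicate j nothing)))

polynomial-sumSubsets : ∀ n {f : Subset n → ℕ → ℕ} → (∀ C → Polynomial (f C)) →
                        Polynomial (λ k → sumSubsets n (λ C → f C k))
polynomial-sumSubsets zero    poly = poly []
polynomial-sumSubsets (suc n) poly =
  polynomial-+ (polynomial-sumSubsets n (poly ∘ (false ∷_))) (polynomial-sumSubsets n (poly ∘ (true ∷_)))

polynomial-sumWhere : ∀ {n} {Q : Pred (Subset n) 0ℓ} (Q? : Decidable Q) {f : Subset n → ℕ → ℕ} →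
                      (∀ {C} → Q C → Polynomial (f C)) → Polynomial (λ k → sumWhere Q? (λ C → f C k))
polynomial-sumWhere {n} {Q} Q? {f} poly = polynomial-sumSubsets n λ C → term C (Q? C)
  where
  term : ∀ C (q? : Dec (Q C)) → Polynomial (λ k → if does q? then f C k else 0)
  term C (yes q) = poly q
  term C (no _)  = polynomial-const 0

P-polynomial : ∀ {n} (H : Hypergraph n) → EdgesInside H → Polynomial (P H)
P-polynomial H = go H (<-wellFounded ∣ V H ∣)
  where
  go : ∀ {n} (H : Hypergraph n) → Acc _<_ ∣ V H ∣ → EdgesInside H → Polynomial (P H)
  go H (acc smaller) inside with nonempty? (V H)
  ... | no  ∅          = polynomial-cong (λ k → sym (P-no-vertices H ∅ k)) (polynomial-const (P H 0))
  ... | yes (v , v∈V) =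
    polynomial-suc* (polynomial-sumWhere (independent? H ∩? (v ∈?_)) λ {C} (_ , v∈C) →
                       go (H ∖ᴴ C) (smaller (p∩q≢∅⇒∣p─q∣<∣p∣ (V H) C (v , x∈p∩q⁺ (v∈V , v∈C))))
                          (edgesInside-induced H (V H ─ C)))
                    (trans (P≡count H 0) (count-no-colours (V H) (v , v∈V) (proper? H)))
                    (P-suc-vertex H inside v∈V)

Psum-polynomial : ∀ {n} (H : Hypergraph n) → EdgesInside H → ∀ V₁ V₂ → Polynomial (Psum H V₁ V₂)
Psum-polynomial H inside V₁ V₂ =
  polynomial-cong (λ k → sym (sum-map-filter-subsets (inI₁₂? H V₁ V₂) (λ C → P (H ∖ᴴ C) k)))
                  (polynomial-sumWhere (inI₁₂? H V₁ V₂) λ {C} _ → P-polynomial (H ∖ᴴ C) (edgesInside-induced H (V H ─ C)))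

edgeOf : ∀ {n} {H : Hypergraph n} {v u} → Linked H v u → ∃[ e ] e ∈ₗ E H
edgeOf (single e∈E _ _) = _ , e∈E
edgeOf (step e∈E _ _ _) = _ , e∈E

module CutVertex {n : ℕ} (H : Hypergraph n) (inside : EdgesInside H) {e : Subset n} (e∈E : e ∈ₗ E H)
                 (w : Fin n) (V₁ V₂ : Subset n) (V₁∪V₂≡V : V₁ ∪ V₂ ≡ V H) (V₁∩V₂≡w : V₁ ∩ V₂ ≡ ⁅ w ⁆)
                 (split : All (λ e → w ∈ e ⊎ (e ⊆ V₁ ⊎ e ⊆ V₂)) (E H)) where

  covers? : Decidable (λ C → V₁ ⊆ C ⊎ V₂ ⊆ C)
  covers? C = (V₁ ⊆? C) ⊎-dec (V₂ ⊆? C)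

  w∈V₁×V₂ : w ∈ V₁ × w ∈ V₂
  w∈V₁×V₂ = x∈p∩q⁻ V₁ V₂ (subst (w ∈_) (sym V₁∩V₂≡w) (x∈⁅x⁆ w))

  w∈V : w ∈ V H
  w∈V = subst (w ∈_) V₁∪V₂≡V (x∈p∪q⁺ (inj₁ (proj₁ w∈V₁×V₂)))

  covers⇒w∈ : ∀ {C} → V₁ ⊆ C ⊎ V₂ ⊆ C → w ∈ C
  covers⇒w∈ (inj₁ V₁⊆C) = V₁⊆C (proj₁ w∈V₁×V₂)
  covers⇒w∈ (inj₂ V₂⊆C) = V₂⊆C (proj₂ w∈V₁×V₂)

  remainder : ℕ → ℕ
  remainder k = sumWhere ((independent? H ∩? (w ∈?_)) ∩? ∁? covers?) (λ C → P (H ∖ᴴ C) k)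
              + sumWhere (independent? H ∩? ∁? (w ∈?_)) (λ C → P (H ∖ᴴ C) k)

  P-suc≡Psum+remainder : ∀ k → P H (suc k) ≡ Psum H V₁ V₂ k + remainder k
  P-suc≡Psum+remainder k = begin
    P H (suc k)
      ≡⟨ P-suc H inside k ⟩
    sumWhere (independent? H) f
      ≡⟨ sumWhere-split (independent? H) (w ∈?_) f ⟩
    sumWhere (independent? H ∩? (w ∈?_)) f + avoiding
      ≡⟨ cong (_+ avoiding) (sumWhere-split (independent? H ∩? (w ∈?_)) covers? f) ⟩
    sumWhere ((independent? H ∩? (w ∈?_)) ∩? covers?) f + separated + avoiding
      ≡⟨ cong (λ s → s + separated + avoiding)
              (sumWhere-cong-⇔ ((independent? H ∩? (w ∈?_)) ∩? covers?) (inI₁₂? H V₁ V₂) f λ C →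
                mk⇔ (λ ((i , _) , c) → i , c) (λ (i , c) → (i , covers⇒w∈ c) , c)) ⟩
    sumWhere (inI₁₂? H V₁ V₂) f + separated + avoiding
      ≡⟨ +-assoc (sumWhere (inI₁₂? H V₁ V₂) f) separated avoiding ⟩
    sumWhere (inI₁₂? H V₁ V₂) f + remainder k
      ≡⟨ cong (_+ remainder k) (sym (sum-map-filter-subsets (inI₁₂? H V₁ V₂) f)) ⟩
    Psum H V₁ V₂ k + remainder k ∎
    where
    f : Subset n → ℕ
    f C = P (H ∖ᴴ C) k
    separated avoiding : ℕ
    separated = sumWhere ((independent? H ∩? (w ∈?_)) ∩? ∁? covers?) f
    avoiding  = sumWhere (independent? H ∩? ∁? (w ∈?_)) f

  square∣P-separated : ∀ {C} → w ∈ C → ¬ (V₁ ⊆ C ⊎ V₂ ⊆ C) → ∀ m → suc m ℕ.* suc m ∣ P (H ∖ᴴ C) (suc m)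
  square∣P-separated {C} w∈C ¬covers m =
    subst (suc m ℕ.* suc m ∣_) (sym (P-induced-∪ (H ∖ᴴ C) (V₁ ─ C) (V₂ ─ C) V─C≡ disjoint cover (suc m)))
          (*-pres-∣ (part V₁ (¬covers ∘ inj₁)) (part V₂ (¬covers ∘ inj₂)))
    where
    part : ∀ U → U ⊈ C → suc m ∣ P (induced (H ∖ᴴ C) (U ─ C)) (suc m)
    part U U⊈C = let (x , x∈U , x∉C) = ⊈-witness U⊈C in
      suc∣P-suc (induced (H ∖ᴴ C) (U ─ C)) (edgesInside-induced (H ∖ᴴ C) (U ─ C)) (x , x∈p∧x∉q⇒x∈p─q x∈U x∉C) m

    V─C≡ : V H ─ C ≡ (V₁ ─ C) ∪ (V₂ ─ C)
    V─C≡ = trans (cong (_─ C) (sym V₁∪V₂≡V)) (─-distribʳ-∪ V₁ V₂ C)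

    disjoint : Empty ((V₁ ─ C) ∩ (V₂ ─ C))
    disjoint (x , x∈) =
      let (x∈V₁─C , x∈V₂─C) = x∈p∩q⁻ (V₁ ─ C) (V₂ ─ C) x∈
          x≡w = x∈⁅y⁆⇒x≡y w (subst (x ∈_) V₁∩V₂≡w (x∈p∩q⁺ (p─q⊆p V₁ C x∈V₁─C , p─q⊆p V₂ C x∈V₂─C)))
      in x∈p─q⇒x∉q V₁ C x∈V₁─C (subst (_∈ C) (sym x≡w) w∈C)

    side : ∀ {e} → e ⊆ V H ─ C × (w ∈ e ⊎ (e ⊆ V₁ ⊎ e ⊆ V₂)) → e ⊆ V₁ ─ C ⊎ e ⊆ V₂ ─ C
    side (e⊆V─C , inj₁ w∈e)          = ⊥-elim (x∈p─q⇒x∉q (V H) C (e⊆V─C w∈e) w∈C)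
    side (e⊆V─C , inj₂ (inj₁ e⊆V₁)) = inj₁ λ x∈e → x∈p∧x∉q⇒x∈p─q (e⊆V₁ x∈e) (x∈p─q⇒x∉q (V H) C (e⊆V─C x∈e))
    side (e⊆V─C , inj₂ (inj₂ e⊆V₂)) = inj₂ λ x∈e → x∈p∧x∉q⇒x∈p─q (e⊆V₂ x∈e) (x∈p─q⇒x∉q (V H) C (e⊆V─C x∈e))

    cover : All (λ e → e ⊆ V₁ ─ C ⊎ e ⊆ V₂ ─ C) (E (H ∖ᴴ C))
    cover = All.zipWith side (all-filter (_⊆? V H ─ C) (E H) , filter⁺ (_⊆? V H ─ C) split)

  square∣remainder : ∀ m → suc m ℕ.* suc m ∣ remainder (suc m)
  square∣remainder m = ∣m∣n⇒∣m+n
    (sumWhere-∣ ((independent? H ∩? (w ∈?_)) ∩? ∁? covers?) _ λ ((_ , w∈C) , ¬covers) → square∣P-separated w∈C ¬covers m)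
    (subst (suc m ℕ.* suc m ∣_) (sym (sumWhere-independent-∌ H inside w∈V (suc m)))
           (*-monoʳ-∣ (suc m) (sumWhere-∣ (independent? H ∩? (w ∈?_)) _ λ {C} (indep , _) →
              suc∣P-suc (H ∖ᴴ C) (edgesInside-induced H (V H ─ C)) (independent⇒Nonempty-─ H inside indep e∈E) m)))

proposition9 : ∀ {n : ℕ} (H : Hypergraph n) (w : Fin n) (V₁ V₂ : Subset n)
    → WellFormed H → Connected H
    → w ∈ V H → V₁ ⊂ V H → V₂ ⊂ V H
    → V₁ ∪ V₂ ≡ V H → V₁ ∩ V₂ ≡ ⁅ w ⁆
    → All (λ e → w ∈ e ⊎ (e ⊆ V₁ ⊎ e ⊆ V₂)) (E H)
    → PolyDivides (λ x → (x - 1ℤ) * (x - 1ℤ)) (P H)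
    ⇔ PolyDivides (λ x → x * x) (Psum H V₁ V₂)
proposition9 H w V₁ V₂ wellFormed connected w∈V _ _ V₁∪V₂≡V V₁∩V₂≡w split =
  square-factor-shift⇔ (P-polynomial H inside) (Psum-polynomial H inside V₁ V₂)
    λ m → remainder (suc m) , P-suc≡Psum+remainder (suc m) , square∣remainder m
  where
  -- Connectivity only supplies an edge, so that no independent set is all of V H.
  inside : EdgesInside H
  inside = All.map proj₂ wellFormed
  open CutVertex H inside (proj₂ (edgeOf (connected w w w∈V w∈V))) w V₁ V₂ V₁∪V₂≡V V₁∩V₂≡w split
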